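{- Let $X$ be a set of $n$ cards, $a,b,c$ positive integers with $a+b+c=n$, and let $d=a-c\ge 2$ with $b\ge d-1$. Suppose Alice's $(a,b,c)$-strategy is informative for Bob and weakly $(d-1)$-secure against Cathy, and let $\mathcal{A}_i$ be one of its announcements. If $H_A\in\mathcal{A}_i$ and $Y\subset H_A$ with $|Y|=c$, then $\mathcal{P}(Y,i)\neq\emptyset$.
   Context: An $(a,b,c)$-deal is a uniformly random partition of $X$ into Alice's hand $H_A$ ($a$ cards), Bob's hand $H_B$ ($b$ cards) and Cathy's hand $H_C$ ($c$ cards). An announcement is a set of $a$-subsets of $X$. An $(a,b,c)$-strategy consists of announcements $\mathcal{A}_1,\dots,\mathcal{A}_m$ covering all $a$-subsets of $X$ together with, for each $H_A$, a probability distribution $p_{H_A}$ with positive values on $g(H_A)=\{i : H_A\in\mathcal{A}_i\}$; Alice broadcasts an index $i$ chosen according to $p_{H_A}$. For $H\subseteq X$, $\mathcal{P}(H,i)=\{H_A\in\mathcal{A}_i : H_A\cap H=\emptyset\}$. Informative for Bob: $|\mathcal{P}(H_B,i)|\le 1$ for every $b$-subset $H_B$ and every $i$. For $1\le\delta\le a$, the strategy is weakly $\delta$-secure against Cathy if for every $\delta'$ with $1\le\delta'\le\delta$, every $i$, every $c$-subset $H_C$ with $\mathcal{P}(H_C,i)\neq\emptyset$ and all distinct $x_1,\dots,x_{\delta'}\in X\setminus H_C$, $0<\Pr[x_1,\dots,x_{\delta'}\in H_A\mid i,H_C]<1$ (probability over the deal and Alice's choice). -}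

module Defs where

open import Data.Bool using (Bool; true; false; T; _∧_; _∨_; not; if_then_else_)
open import Data.Nat using (ℕ; zero; suc; _≤_)
open import Data.Fin using (Fin)
open import Data.Fin.Subset using (Subset; ∣_∣; inside; outside)
open import Data.Vec using (Vec; []; _∷_)
open import Data.List using (List; []; _∷_; map; _++_; filter; foldr; length; [_])
open import Data.List.Base using (allFin)
open import Data.Product using (∃; _×_)
open import Data.Rational using (ℚ; 0ℚ; 1ℚ; _+_; _÷_; _<_; ≢-nonZero)
import Data.Rational.Properties as ℚP
open import Relation.Nullary using (¬_; yes; no)
open import Relation.Nullary.Decidable using (does)
open import Relation.Binary.PropositionalEquality using (_≡_; _≢_)

-- The card set X is Fin n; subsets of X are Subset n (= Vec Bool n).

allSubsets : (n : ℕ) → List (Subset n)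
allSubsets zero = [ [] ]
allSubsets (suc n) = map (outside ∷_) (allSubsets n) ++ map (inside ∷_) (allSubsets n)

disjointᵇ : ∀ {n} → Subset n → Subset n → Bool
disjointᵇ [] [] = true
disjointᵇ (x ∷ xs) (y ∷ ys) = not (x ∧ y) ∧ disjointᵇ xs ys

⊆ᵇ : ∀ {n} → Subset n → Subset n → Bool
⊆ᵇ [] [] = true
⊆ᵇ (x ∷ xs) (y ∷ ys) = (not x ∨ y) ∧ ⊆ᵇ xs ys

Σℚ : List ℚ → ℚ
Σℚ = foldr _+_ 0ℚ

-- Total division (value irrelevant when the denominator is 0; only used with positive ones).
_÷ₜ_ : ℚ → ℚ → ℚ
p ÷ₜ q with q ℚP.≟ 0ℚ
... | yes _ = 0ℚ
... | no q≢0 = _÷_ p q {{≢-nonZero q≢0}}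

record Strategy (n a b c : ℕ) : Set where
  field
    m      : ℕ
    ann    : Fin m → Subset n → Bool        -- H ∈ 𝒜ᵢ  iff  T (ann i H)
    ann-a  : ∀ i H → T (ann i H) → ∣ H ∣ ≡ a
    cover  : ∀ H → ∣ H ∣ ≡ a → ∃ λ i → T (ann i H)
    p      : Subset n → Fin m → ℚ
    p-pos  : ∀ H → ∣ H ∣ ≡ a → ∀ i → T (ann i H) → 0ℚ < p H i
    p-zero : ∀ H → ∣ H ∣ ≡ a → ∀ i → ¬ T (ann i H) → p H i ≡ 0ℚ
    p-sum  : ∀ H → ∣ H ∣ ≡ a → Σℚ (map (p H) (allFin m)) ≡ 1ℚ

module _ {n a b c : ℕ} (σ : Strategy n a b c) where
  open Strategy σ

  -- 𝒫(H,i) = { H_A ∈ 𝒜ᵢ : H_A ∩ H = ∅ }, as a duplicate-free list.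
  𝒫 : Subset n → Fin m → List (Subset n)
  𝒫 H i = filter (λ K → T? (ann i K ∧ disjointᵇ K H)) (allSubsets n)
    where
      open import Data.Bool.Properties using (T?)

  -- The deal is uniform, so the joint weight of a deal
  -- (H_A, X∖(H_A∪H_C), H_C) with announcement i is (1/#deals)·p_{H_A}(i);
  -- the constant 1/#deals cancels in the conditional probability.
  Pr : Subset n → Fin m → Subset n → ℚ
  Pr S i HC =
    Σℚ (map (λ K → if ⊆ᵇ S K then p K i else 0ℚ) (𝒫 HC i))
      ÷ₜ Σℚ (map (λ K → p K i) (𝒫 HC i))

  Informative : Set
  Informative = ∀ (HB : Subset n) → ∣ HB ∣ ≡ b → ∀ i → length (𝒫 HB i) ≤ 1

  -- A set S of δ' distinct cards x₁,…,x_δ' outside H_C; "x₁,…,x_δ' ∈ H_A" is S ⊆ H_A.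
  WeaklySecure : ℕ → Set
  WeaklySecure δ =
    ∀ (δ' : ℕ) → 1 ≤ δ' → δ' ≤ δ →
    ∀ i (HC : Subset n) → ∣ HC ∣ ≡ c → 𝒫 HC i ≢ [] →
    ∀ (S : Subset n) → ∣ S ∣ ≡ δ' → T (disjointᵇ S HC) →
    (0ℚ < Pr S i HC) × (Pr S i HC < 1ℚ)

-- Call a c-set H consistent with announcement i if some hand of 𝒜ᵢ avoids H,
-- i.e. 𝒫(H,i) ≠ ∅. Weak 1-security says that a Cathy holding a consistent H
-- cannot be sure that a card x ∉ H is in Alice's hand, so some hand of 𝒫(H,i)
-- also avoids x: H ∪ {x} is still consistent, and so is every c-subset of it.
-- Exchanging one card at a time therefore moves consistency from one c-set to
-- every other c-set. A c-subset of X ∖ H_A (which exists as a + c ≤ n) is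
-- consistent, witnessed by H_A itself, hence so is Y.
module Submission where

open import Defs
open import Data.Bool using (Bool; true; T; _∧_; if_then_else_)
open import Data.Bool.Properties using (T?; T-∧)
open import Data.Fin using (Fin; zero; suc)
open import Data.Fin.Properties using (¬∀⟶∃¬)
open import Data.Fin.Subset
  using (Subset; inside; outside; _∈_; _∉_; _⊆_; _⊈_; ⊥; ∁; _∪_; _─_; _-_; ⁅_⁆; ∣_∣)
open import Data.Fin.Subset.Properties
  using ( drop-there; _∈?_; _⊆?_; ⊆-trans; ⊥⊆; ∣⊥∣≡0; out⊆; s⊆s; x∈⁅x⁆; x∈⁅y⁆⇒x≡y; ∣⁅x⁆∣≡1
        ; x∉p⇒x∈∁p; x∈∁p⇒x∉p; p⊆q⇒∁p⊇∁q; ∪-identityʳ; x∈p∪q⁺; x∈p∪q⁻; p⊆p∪q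
        ; p─⊥≡p; p─q⊆p; x∈p∧x∉q⇒x∈p─q; x∈p∧x≢y⇒x∈p-y; x∈p⇒∣p-x∣<∣p∣
        ; p⊆q⇒∣p∣≤∣q∣; p⊂q⇒∣p∣<∣q∣; ∣∁p∣≡n∸∣p∣ )
open import Data.List using ([]; _∷_; map)
import Data.List.Membership.Propositional as List
open import Data.List.Membership.Propositional.Properties
  using (∈-filter⁺; ∈-filter⁻; ∈-map⁺; ∈-++⁺ˡ; ∈-++⁺ʳ)
open import Data.List.Relation.Unary.All using (All; []; _∷_; all?)
open import Data.List.Relation.Unary.All.Properties using (¬All⇒Any¬)
import Data.List.Relation.Unary.Any as Any
open import Data.Nat using (ℕ; zero; suc; _+_; _∸_; _≤_; _<_; s≤s)
open import Data.Nat.Induction using (<-wellFounded)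
open import Data.Nat.Properties
  using (≤-refl; ≤-<-trans; <-irrefl; suc-injective; +-assoc; m+n∸m≡n; m≤n+m; ∸-monoˡ-≤)
open import Data.Product using (∃; _×_; _,_; proj₂)
open import Data.Sum using (_⊎_; inj₁; inj₂)
open import Data.Unit using (tt)
open import Data.Vec using ([]; _∷_; here; there)
open import Data.Rational as ℚ using (ℚ; 0ℚ; 1ℚ; ≢-nonZero)
import Data.Rational.Properties as ℚₚ
open import Function using (_∘_; Equivalence; case_of_)
open import Induction.WellFounded using (Acc; acc)
open import Relation.Nullary using (¬_; yes; no; contradiction)
open import Relation.Nullary.Decidable using (_→-dec_)
open import Relation.Binary.PropositionalEquality
  using (_≡_; _≢_; refl; sym; trans; cong; subst; module ≡-Reasoning)

private
  variable
    n : ℕ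
    x w : Fin n
    p q : Subset n

x∈p⇒⁅x⁆⊆p : x ∈ p → ⁅ x ⁆ ⊆ p
x∈p⇒⁅x⁆⊆p {x = x} x∈p y∈⁅x⁆ = subst (_∈ _) (sym (x∈⁅y⁆⇒x≡y x y∈⁅x⁆)) x∈p

p⊆∁q⇒q⊆∁p : p ⊆ ∁ q → q ⊆ ∁ p
p⊆∁q⇒q⊆∁p p⊆∁q y∈q = x∉p⇒x∈∁p (λ y∈p → x∈∁p⇒x∉p (p⊆∁q y∈p) y∈q)

x∈p─q⇒x∉q : x ∈ p ─ q → x ∉ q
x∈p─q⇒x∉q {p = _ ∷ _} {q = outside ∷ _} here        ()
x∈p─q⇒x∉q {p = _ ∷ _} {q = _ ∷ _}       (there x∈p─q) (there x∈q) = x∈p─q⇒x∉q x∈p─q x∈q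

p⊈q⇒∃∉ : p ⊈ q → ∃ λ x → x ∈ p × x ∉ q
p⊈q⇒∃∉ {n} {p} {q} p⊈q
  with ¬∀⟶∃¬ n (λ x → x ∈ p → x ∈ q) (λ x → x ∈? p →-dec x ∈? q) (λ p⊆q → p⊈q (p⊆q _))
... | x , x∈p↛x∈q with x ∈? p
...   | yes x∈p = x , x∈p , λ x∈q → x∈p↛x∈q (λ _ → x∈q)
...   | no  x∉p = contradiction (λ x∈p → contradiction x∈p x∉p) x∈p↛x∈q

∣p∪⁅x⁆∣≡1+∣p∣ : x ∉ p → ∣ p ∪ ⁅ x ⁆ ∣ ≡ suc ∣ p ∣
∣p∪⁅x⁆∣≡1+∣p∣ {x = zero}  {p = outside ∷ p} _   = cong (suc ∘ ∣_∣) (∪-identityʳ p)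
∣p∪⁅x⁆∣≡1+∣p∣ {x = zero}  {p = inside  ∷ p} x∉p = contradiction here x∉p
∣p∪⁅x⁆∣≡1+∣p∣ {x = suc x} {p = outside ∷ p} x∉p = ∣p∪⁅x⁆∣≡1+∣p∣ (x∉p ∘ there)
∣p∪⁅x⁆∣≡1+∣p∣ {x = suc x} {p = inside  ∷ p} x∉p = cong suc (∣p∪⁅x⁆∣≡1+∣p∣ (x∉p ∘ there))

1+∣p-x∣≡∣p∣ : x ∈ p → suc ∣ p - x ∣ ≡ ∣ p ∣
1+∣p-x∣≡∣p∣ {p = inside  ∷ p} here        = cong (suc ∘ ∣_∣) (p─⊥≡p p)
1+∣p-x∣≡∣p∣ {p = outside ∷ p} (there x∈p) = 1+∣p-x∣≡∣p∣ x∈p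
1+∣p-x∣≡∣p∣ {p = inside  ∷ p} (there x∈p) = cong suc (1+∣p-x∣≡∣p∣ x∈p)

∃⊆-ofSize : ∀ k (p : Subset n) → k ≤ ∣ p ∣ → ∃ λ q → q ⊆ p × ∣ q ∣ ≡ k
∃⊆-ofSize {n} zero    _             _           = ⊥ , ⊥⊆ , ∣⊥∣≡0 n
∃⊆-ofSize     (suc k) (outside ∷ p) k<∣p∣       =
  let q , q⊆p , ∣q∣≡k = ∃⊆-ofSize (suc k) p k<∣p∣ in outside ∷ q , out⊆ q⊆p , ∣q∣≡k
∃⊆-ofSize     (suc k) (inside ∷ p)  (s≤s k≤∣p∣) =
  let q , q⊆p , ∣q∣≡k = ∃⊆-ofSize k p k≤∣p∣ in inside ∷ q , s⊆s q⊆p , cong suc ∣q∣≡k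

∣p∣≡∣q∣∧q⊈p⇒p⊈q : ∣ p ∣ ≡ ∣ q ∣ → q ⊈ p → p ⊈ q
∣p∣≡∣q∣∧q⊈p⇒p⊈q ∣p∣≡∣q∣ q⊈p p⊆q =
  let x , x∈q , x∉p = p⊈q⇒∃∉ q⊈p in <-irrefl ∣p∣≡∣q∣ (p⊂q⇒∣p∣<∣q∣ (p⊆q , x , x∈q , x∉p))

∣[p∪⁅x⁆]-w∣≡∣p∣ : x ∉ p → w ∈ p → ∣ (p ∪ ⁅ x ⁆) - w ∣ ≡ ∣ p ∣
∣[p∪⁅x⁆]-w∣≡∣p∣ {x = x} x∉p w∈p =
  suc-injective (trans (1+∣p-x∣≡∣p∣ (p⊆p∪q ⁅ x ⁆ w∈p)) (∣p∪⁅x⁆∣≡1+∣p∣ x∉p))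

∣q─[p∪⁅x⁆-w]∣<∣q─p∣ : x ∈ q → x ∉ p → w ∉ q → ∣ q ─ ((p ∪ ⁅ x ⁆) - w) ∣ < ∣ q ─ p ∣
∣q─[p∪⁅x⁆-w]∣<∣q─p∣ {x = x} {q = q} {p = p} {w = w} x∈q x∉p w∉q =
  ≤-<-trans (p⊆q⇒∣p∣≤∣q∣ q─p′⊆[q─p]-x) (x∈p⇒∣p-x∣<∣p∣ (x∈p∧x∉q⇒x∈p─q x∈q x∉p))
  where
  p′ = (p ∪ ⁅ x ⁆) - w

  q─p′⊆[q─p]-x : q ─ p′ ⊆ (q ─ p) - x
  q─p′⊆[q─p]-x {y} y∈q─p′ = x∈p∧x≢y⇒x∈p-y (x∈p∧x∉q⇒x∈p─q y∈q y∉p) y≢x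
    where
    y∈q = p─q⊆p q p′ y∈q─p′
    y∉p′ = x∈p─q⇒x∉q y∈q─p′
    y≢w : y ≢ w
    y≢w refl = w∉q y∈q
    y∉p : y ∉ p
    y∉p y∈p = y∉p′ (x∈p∧x≢y⇒x∈p-y (p⊆p∪q ⁅ x ⁆ y∈p) y≢w)
    y≢x : y ≢ x
    y≢x refl = y∉p′ (x∈p∧x≢y⇒x∈p-y (x∈p∪q⁺ (inj₂ (x∈⁅x⁆ y))) y≢w)

module _ {n k : ℕ} (P : Subset n → Set)
         (P-antitone : ∀ {p q} → p ⊆ q → P q → P p)
         (P-extend : ∀ {p x} → ∣ p ∣ ≡ k → P p → x ∉ p → P (p ∪ ⁅ x ⁆))
         where

  sameSize-transfer : ∀ {p q} → ∣ p ∣ ≡ k → ∣ q ∣ ≡ k → P p → P q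
  sameSize-transfer {p} {q} ∣p∣≡k ∣q∣≡k = go p (<-wellFounded ∣ q ─ p ∣) ∣p∣≡k
    where
    go : ∀ p → Acc _<_ ∣ q ─ p ∣ → ∣ p ∣ ≡ k → P p → P q
    go p (acc rec) ∣p∣≡k Pp with q ⊆? p
    ... | yes q⊆p = P-antitone q⊆p Pp
    ... | no  q⊈p =
      let x , x∈q , x∉p = p⊈q⇒∃∉ q⊈p
          w , w∈p , w∉q = p⊈q⇒∃∉ (∣p∣≡∣q∣∧q⊈p⇒p⊈q (trans ∣p∣≡k (sym ∣q∣≡k)) q⊈p)
      in go ((p ∪ ⁅ x ⁆) - w) (rec (∣q─[p∪⁅x⁆-w]∣<∣q─p∣ x∈q x∉p w∉q))
            (trans (∣[p∪⁅x⁆]-w∣≡∣p∣ x∉p w∈p) ∣p∣≡k)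
            (P-antitone (p─q⊆p _ _) (P-extend ∣p∣≡k Pp x∉p))

disjointᵇ⇒⊆∁ : T (disjointᵇ p q) → p ⊆ ∁ q
disjointᵇ⇒⊆∁ {p = inside ∷ _} {q = outside ∷ _} _ here = here
disjointᵇ⇒⊆∁ {p = _ ∷ _} {q = _ ∷ _} p∩q=∅ (there x∈p) =
  there (disjointᵇ⇒⊆∁ (proj₂ (Equivalence.to T-∧ p∩q=∅)) x∈p)

⊆∁⇒disjointᵇ : p ⊆ ∁ q → T (disjointᵇ p q)
⊆∁⇒disjointᵇ {p = []}          {q = []}          _    = tt
⊆∁⇒disjointᵇ {p = outside ∷ _} {q = _ ∷ _}       p⊆∁q = ⊆∁⇒disjointᵇ (drop-there ∘ p⊆∁q ∘ there)
⊆∁⇒disjointᵇ {p = inside ∷ _}  {q = outside ∷ _} p⊆∁q = ⊆∁⇒disjointᵇ (drop-there ∘ p⊆∁q ∘ there)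
⊆∁⇒disjointᵇ {p = inside ∷ _}  {q = inside ∷ _}  p⊆∁q with p⊆∁q here
... | ()

⊆⇒⊆ᵇ : p ⊆ q → T (⊆ᵇ p q)
⊆⇒⊆ᵇ {p = []}          {q = []}          _   = tt
⊆⇒⊆ᵇ {p = outside ∷ _} {q = _ ∷ _}       p⊆q = ⊆⇒⊆ᵇ (drop-there ∘ p⊆q ∘ there)
⊆⇒⊆ᵇ {p = inside ∷ _}  {q = inside ∷ _}  p⊆q = ⊆⇒⊆ᵇ (drop-there ∘ p⊆q ∘ there)
⊆⇒⊆ᵇ {p = inside ∷ _}  {q = outside ∷ _} p⊆q with p⊆q here
... | ()

allSubsets-complete : ∀ n (p : Subset n) → p List.∈ allSubsets n
allSubsets-complete zero    []            = Any.here refl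
allSubsets-complete (suc n) (outside ∷ p) = ∈-++⁺ˡ (∈-map⁺ (outside ∷_) (allSubsets-complete n p))
allSubsets-complete (suc n) (inside ∷ p)  =
  ∈-++⁺ʳ (map (outside ∷_) (allSubsets n)) (∈-map⁺ (inside ∷_) (allSubsets-complete n p))

Σℚ-if-All : ∀ {A : Set} (g : A → Bool) (f : A → ℚ) {xs} → All (T ∘ g) xs →
            Σℚ (map (λ x → if g x then f x else 0ℚ) xs) ≡ Σℚ (map f xs)
Σℚ-if-All g f []                      = refl
Σℚ-if-All g f {x ∷ _} (gx ∷ gxs) with g x
... | true = cong (f x ℚ.+_) (Σℚ-if-All g f gxs)

q÷ₜq≡0⊎1 : ∀ q → q ÷ₜ q ≡ 0ℚ ⊎ q ÷ₜ q ≡ 1ℚ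
q÷ₜq≡0⊎1 q with q ℚₚ.≟ 0ℚ
... | yes _   = inj₁ refl
... | no  q≢0 = inj₂ (ℚₚ.*-inverseʳ q {{≢-nonZero q≢0}})

module _ {n a b c : ℕ} (σ : Strategy n a b c) (i : Fin (Strategy.m σ)) where
  open Strategy σ using (ann)

  Consistent : Subset n → Set
  Consistent H = ∃ λ K → T (ann i K) × K ⊆ ∁ H

  consistent-antitone : ∀ {H H′} → H′ ⊆ H → Consistent H → Consistent H′
  consistent-antitone H′⊆H (K , K∈𝒜ᵢ , K⊆∁H) = K , K∈𝒜ᵢ , ⊆-trans K⊆∁H (p⊆q⇒∁p⊇∁q H′⊆H)

  consistent⇒𝒫≢[] : ∀ {H} → Consistent H → 𝒫 σ H i ≢ []
  consistent⇒𝒫≢[] {H} (K , K∈𝒜ᵢ , K⊆∁H) 𝒫≡[] = case subst (K List.∈_) 𝒫≡[] K∈𝒫 of λ ()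
    where
    K∈𝒫 : K List.∈ 𝒫 σ H i
    K∈𝒫 = ∈-filter⁺ (λ K → T? (ann i K ∧ disjointᵇ K H)) (allSubsets-complete n K)
                    (Equivalence.from T-∧ (K∈𝒜ᵢ , ⊆∁⇒disjointᵇ K⊆∁H))

  ∈𝒫⇒∈𝒜ᵢ×⊆∁ : ∀ {H K} → K List.∈ 𝒫 σ H i → T (ann i K) × K ⊆ ∁ H
  ∈𝒫⇒∈𝒜ᵢ×⊆∁ {H} K∈𝒫 =
    let K∈𝒜ᵢ , K∩H=∅ = Equivalence.to T-∧
                          (proj₂ (∈-filter⁻ (λ K → T? (ann i K ∧ disjointᵇ K H)) {xs = allSubsets n} K∈𝒫))
    in K∈𝒜ᵢ , disjointᵇ⇒⊆∁ K∩H=∅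

  Pr≡0⊎1 : ∀ {S H} → All (T ∘ ⊆ᵇ S) (𝒫 σ H i) → Pr σ S i H ≡ 0ℚ ⊎ Pr σ S i H ≡ 1ℚ
  Pr≡0⊎1 {S} {H} S⊆all =
    subst (λ num → num ÷ₜ den ≡ 0ℚ ⊎ num ÷ₜ den ≡ 1ℚ)
          (sym (Σℚ-if-All (⊆ᵇ S) (λ K → Strategy.p σ K i) S⊆all))
          (q÷ₜq≡0⊎1 den)
    where den = Σℚ (map (λ K → Strategy.p σ K i) (𝒫 σ H i))

  0<Pr<1⇒∃⊈ : ∀ {S H} → 0ℚ ℚ.< Pr σ S i H → Pr σ S i H ℚ.< 1ℚ →
              ∃ λ K → K List.∈ 𝒫 σ H i × ¬ T (⊆ᵇ S K)
  0<Pr<1⇒∃⊈ {S} {H} 0<Pr Pr<1 with all? (T? ∘ ⊆ᵇ S) (𝒫 σ H i)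
  ... | no  ¬S⊆all = List.find (¬All⇒Any¬ (T? ∘ ⊆ᵇ S) _ ¬S⊆all)
  ... | yes S⊆all with Pr≡0⊎1 {S} {H} S⊆all
  ...   | inj₁ Pr≡0 = contradiction 0<Pr (ℚₚ.<-irrefl (sym Pr≡0))
  ...   | inj₂ Pr≡1 = contradiction Pr<1 (ℚₚ.<-irrefl Pr≡1)

  weaklySecure⇒consistent-∪⁅x⁆ : ∀ {δ} → WeaklySecure σ δ → 1 ≤ δ →
                                 ∀ {H x} → ∣ H ∣ ≡ c → Consistent H → x ∉ H → Consistent (H ∪ ⁅ x ⁆)
  weaklySecure⇒consistent-∪⁅x⁆ secure 1≤δ {H} {x} ∣H∣≡c H-consistent x∉H =
    let 0<Pr , Pr<1 = secure 1 ≤-refl 1≤δ i H ∣H∣≡c (consistent⇒𝒫≢[] H-consistent)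
                             ⁅ x ⁆ (∣⁅x⁆∣≡1 x) (⊆∁⇒disjointᵇ (x∈p⇒⁅x⁆⊆p (x∉p⇒x∈∁p x∉H)))
        K , K∈𝒫 , ⁅x⁆⊈K = 0<Pr<1⇒∃⊈ {S = ⁅ x ⁆} 0<Pr Pr<1
        K∈𝒜ᵢ , K⊆∁H = ∈𝒫⇒∈𝒜ᵢ×⊆∁ K∈𝒫
        K⊆∁[H∪⁅x⁆] : K ⊆ ∁ (H ∪ ⁅ x ⁆)
        K⊆∁[H∪⁅x⁆] y∈K = x∉p⇒x∈∁p λ y∈H∪⁅x⁆ → case x∈p∪q⁻ H ⁅ x ⁆ y∈H∪⁅x⁆ of λ where
          (inj₁ y∈H)   → x∈∁p⇒x∉p (K⊆∁H y∈K) y∈H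
          (inj₂ y∈⁅x⁆) → ⁅x⁆⊈K (⊆⇒⊆ᵇ (x∈p⇒⁅x⁆⊆p (subst (_∈ K) (x∈⁅y⁆⇒x≡y x y∈⁅x⁆) y∈K)))
    in K , K∈𝒜ᵢ , K⊆∁[H∪⁅x⁆]

lemma11 : (n a b c : ℕ) → 1 ≤ a → 1 ≤ b → 1 ≤ c → a + b + c ≡ n →
          2 ≤ a ∸ c → a ∸ c ∸ 1 ≤ b →
          (σ : Strategy n a b c) →
          Informative σ → WeaklySecure σ (a ∸ c ∸ 1) →
          ∀ i (HA : Subset n) → T (Strategy.ann σ i HA) →
          ∀ (Y : Subset n) → Y ⊆ HA → ∣ Y ∣ ≡ c →
          𝒫 σ Y i ≢ []
lemma11 n a b c _ _ _ a+b+c≡n 2≤a∸c _ σ _ secure i HA HA∈𝒜ᵢ Y _ ∣Y∣≡c =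
  let HC , HC⊆∁HA , ∣HC∣≡c = ∃⊆-ofSize c (∁ HA) (subst (c ≤_) (sym ∣∁HA∣≡b+c) (m≤n+m c b))
  in consistent⇒𝒫≢[] σ i
       (sameSize-transfer (Consistent σ i) (consistent-antitone σ i)
                          (weaklySecure⇒consistent-∪⁅x⁆ σ i secure (∸-monoˡ-≤ 1 2≤a∸c))
                          ∣HC∣≡c ∣Y∣≡c (HA , HA∈𝒜ᵢ , p⊆∁q⇒q⊆∁p HC⊆∁HA))
  where
  ∣∁HA∣≡b+c : ∣ ∁ HA ∣ ≡ b + c
  ∣∁HA∣≡b+c = begin
    ∣ ∁ HA ∣          ≡⟨ ∣∁p∣≡n∸∣p∣ HA ⟩
    n ∸ ∣ HA ∣        ≡⟨ cong (n ∸_) (Strategy.ann-a σ i HA HA∈𝒜ᵢ) ⟩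
    n ∸ a             ≡⟨ cong (_∸ a) (trans (sym a+b+c≡n) (+-assoc a b c)) ⟩
    a + (b + c) ∸ a   ≡⟨ m+n∸m≡n a (b + c) ⟩
    b + c             ∎
    where open ≡-Reasoning
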